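{- Let $V$ be a linear subspace of $M_{m,n}(\mathbb{K})$ and let $M_1,\ldots,M_p$ be a basis of $V$ ordered by nondecreasing rank ($\operatorname{rank} M_i \leq \operatorname{rank} M_{i+1}$). If the subspaces $\operatorname{Im} M_1,\ldots,\operatorname{Im} M_p$ are in direct sum, then for all $i\in\{1,\dots,p\}$, $$\min \{\operatorname{rank} M:\ M \in V \setminus \operatorname{Span}(M_1,\ldots,M_{i-1})\} = \operatorname{rank} M_i .$$ -}

module Defs where

open import Level using (Level; _⊔_)
open import Algebra.Bundles using (CommutativeRing)
open import Data.Nat using (ℕ; zero; suc)
open import Data.Fin using (Fin; zero; suc; inject; toℕ)
open import Data.Product using (Σ; ∃; _×_)
open import Relation.Nullary using (¬_)

record Field (c ℓ : Level) : Set (Level.suc (c ⊔ ℓ)) where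
  field
    commutativeRing : CommutativeRing c ℓ
  open CommutativeRing commutativeRing public
  field
    0≉1     : ¬ (0# ≈ 1#)
    inverse : ∀ x → ¬ (x ≈ 0#) → ∃ λ y → x * y ≈ 1#

module LinearAlgebra {c ℓ : Level} (K : Field c ℓ) where
  open Field K using (Carrier; _≈_; _+_; _*_; 0#; 1#)

  ∑ : ∀ {k} → (Fin k → Carrier) → Carrier
  ∑ {zero}  f = 0#
  ∑ {suc k} f = f zero + ∑ (λ j → f (suc j))

  Vector : ℕ → Set c
  Vector m = Fin m → Carrier

  Matrix : ℕ → ℕ → Set c
  Matrix m n = Fin m → Fin n → Carrier

  _≈ᵥ_ : ∀ {m} → Vector m → Vector m → Set ℓ
  u ≈ᵥ v = ∀ a → u a ≈ v a

  _≈ₘ_ : ∀ {m n} → Matrix m n → Matrix m n → Set ℓ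
  A ≈ₘ B = ∀ a b → A a b ≈ B a b

  0ᵥ : ∀ {m} → Vector m
  0ᵥ a = 0#

  0ₘ : ∀ {m n} → Matrix m n
  0ₘ a b = 0#

  combᵥ : ∀ {m k} → (Fin k → Carrier) → (Fin k → Vector m) → Vector m
  combᵥ λs vs a = ∑ (λ j → λs j * vs j a)

  combₘ : ∀ {m n k} → (Fin k → Carrier) → (Fin k → Matrix m n) → Matrix m n
  combₘ λs Ms a b = ∑ (λ j → λs j * Ms j a b)

  sumᵥ : ∀ {m k} → (Fin k → Vector m) → Vector m
  sumᵥ vs a = ∑ (λ j → vs j a)

  _·_ : ∀ {m n} → Matrix m n → Vector n → Vector m
  (M · x) a = ∑ (λ b → M a b * x b)

  InSpanₘ : ∀ {m n k} → (Fin k → Matrix m n) → Matrix m n → Set (c ⊔ ℓ)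
  InSpanₘ Ms M = ∃ λ (λs : Fin _ → Carrier) → M ≈ₘ combₘ λs Ms

  LinIndepₘ : ∀ {m n k} → (Fin k → Matrix m n) → Set (c ⊔ ℓ)
  LinIndepₘ Ms = ∀ λs → combₘ λs Ms ≈ₘ 0ₘ → ∀ j → λs j ≈ 0#

  IsBasisₘ : ∀ {m n k} {v} → (Matrix m n → Set v) → (Fin k → Matrix m n) → Set (c ⊔ ℓ ⊔ v)
  IsBasisₘ V Ms = LinIndepₘ Ms × (∀ M → (V M → InSpanₘ Ms M) × (InSpanₘ Ms M → V M))

  LinIndepᵥ : ∀ {m k} → (Fin k → Vector m) → Set (c ⊔ ℓ)
  LinIndepᵥ vs = ∀ λs → combᵥ λs vs ≈ᵥ 0ᵥ → ∀ j → λs j ≈ 0#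

  InSpanᵥ : ∀ {m k} → (Fin k → Vector m) → Vector m → Set (c ⊔ ℓ)
  InSpanᵥ vs y = ∃ λ (λs : Fin _ → Carrier) → y ≈ᵥ combᵥ λs vs

  Im : ∀ {m n} → Matrix m n → Vector m → Set (c ⊔ ℓ)
  Im M y = ∃ λ x → (M · x) ≈ᵥ y

  HasDim : ∀ {m} {s} → (Vector m → Set s) → ℕ → Set (c ⊔ ℓ ⊔ s)
  HasDim {m} S r = ∃ λ (vs : Fin r → Vector m) →
    (∀ j → S (vs j)) × LinIndepᵥ vs × (∀ y → S y → InSpanᵥ vs y)

  HasRank : ∀ {m n} → Matrix m n → ℕ → Set (c ⊔ ℓ)
  HasRank M r = HasDim (Im M) r

  ImagesInDirectSum : ∀ {m n k} → (Fin k → Matrix m n) → Set (c ⊔ ℓ)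
  ImagesInDirectSum Ms = ∀ ys → (∀ j → Im (Ms j) (ys j)) → sumᵥ ys ≈ᵥ 0ᵥ → ∀ j → ys j ≈ᵥ 0ᵥ

  -- the first i members of a family (M_1, …, M_{i-1} in 1-based notation
  -- when i : Fin p is the 0-based index of M_i)
  prefix : ∀ {p} {A : Set c} → (Fin p → A) → (i : Fin p) → Fin (toℕ i) → A
  prefix Ms i j = Ms (inject j)

{-# OPTIONS --safe #-}
-- Write M ∈ V as ∑ⱼ λⱼ Mⱼ.  If M ∉ Span(M₁, …, M_{i-1}), some λⱼ with j ≥ i is
-- nonzero.  As the images are in direct sum, M x = 0 forces every λₗ Mₗ x = 0,
-- so Ker M ⊆ Ker Mⱼ and rank M ≥ rank Mⱼ ≥ rank Mᵢ; comparing ranks is the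
-- exchange lemma (r independent vectors in the span of s vectors force r ≤ s).
-- Equality with 0 in K is undecidable, so the choice of j and of the pivots in
-- the exchange lemma happens under a double negation, which is harmless since
-- the conclusions are decidable inequalities in ℕ.
module Submission where

open import Defs
open import Level using (Level)
open import Data.Nat using (ℕ; suc; _≤_)
open import Data.Fin using (Fin; toℕ)
open import Data.Product using (_×_)
open import Relation.Binary.PropositionalEquality using (_≡_)
open import Relation.Nullary using (¬_)

open import Function using (_∘_; flip)
import Data.Nat as ℕ
import Data.Nat.Properties as ℕ
open import Data.Fin using (zero; suc; inject; inject₁; punchIn)
open import Data.Fin.Properties using (toℕ-injective; toℕ-inject₁)
open import Data.Vec.Functional using (tail; insertAt)
open import Data.Vec.Functional.Properties using (insertAt-lookup; insertAt-punchIn)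
open import Data.Product using (_,_; proj₁; proj₂)
open import Data.Empty using (⊥-elim)
open import Relation.Nullary.Decidable using (decidable-stable)
import Relation.Binary.PropositionalEquality as ≡
import Algebra.Properties.Semiring.Sum as SemiringSum
import Algebra.Properties.Ring as RingProperties
import Algebra.Properties.CommutativeSemigroup as CommutativeSemigroupProperties

¬¬-→ : ∀ {a b} {A : Set a} {B : Set b} → (A → ¬ ¬ B) → ¬ ¬ (A → B)
¬¬-→ f ¬[A→B] = ¬[A→B] λ x → ⊥-elim (f x λ y → ¬[A→B] λ _ → y)

¬¬-∀-Fin : ∀ {n q} {P : Fin n → Set q} → (∀ j → ¬ ¬ P j) → ¬ ¬ (∀ j → P j)
¬¬-∀-Fin {ℕ.zero} _ ¬∀ = ¬∀ λ ()
¬¬-∀-Fin {suc n} ¬¬P ¬∀ = ¬¬P zero λ P₀ →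
  ¬¬-∀-Fin (¬¬P ∘ suc) λ P₊ → ¬∀ λ { zero → P₀ ; (suc j) → P₊ j }

suc-step⇒monotone : ∀ {p} (r : Fin p → ℕ) →
                    (∀ j k → toℕ k ≡ suc (toℕ j) → r j ≤ r k) →
                    ∀ {i j} → toℕ i ≤ toℕ j → r i ≤ r j
suc-step⇒monotone r step {i} {j} i≤j = go (toℕ j ℕ.∸ toℕ i) (≡.sym (ℕ.m∸n+n≡m i≤j))
  where
  go : ∀ d {k} → toℕ k ≡ d ℕ.+ toℕ i → r i ≤ r k
  go ℕ.zero  k≡i = ℕ.≤-reflexive (≡.cong r (toℕ-injective (≡.sym k≡i)))
  go (suc d) {suc k} k≡d+i =
    ℕ.≤-trans (go d (≡.trans (toℕ-inject₁ k) (ℕ.suc-injective k≡d+i)))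
              (step (inject₁ k) (suc k) (≡.cong suc (≡.sym (toℕ-inject₁ k))))

module _ {c ℓ} (K : Field c ℓ) where
  open Field K hiding (zero)
  open LinearAlgebra K
  open RingProperties ring using (-1*x≈-x; -‿distribˡ-*)
  open CommutativeSemigroupProperties *-commutativeSemigroup using (x∙yz≈y∙xz; xy∙z≈y∙xz)
  open import Relation.Binary.Reasoning.Setoid setoid
  private module Sum = SemiringSum semiring

  nonzero*y≈0⇒y≈0 : ∀ {x y} → ¬ x ≈ 0# → x * y ≈ 0# → y ≈ 0#
  nonzero*y≈0⇒y≈0 {x} {y} x≉0 xy≈0 = begin
    y                ≈⟨ *-identityˡ y ⟨
    1# * y           ≈⟨ *-congʳ (proj₂ (inverse x x≉0)) ⟨
    (x * x⁻¹) * y    ≈⟨ xy∙z≈y∙xz x x⁻¹ y ⟩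
    x⁻¹ * (x * y)    ≈⟨ *-congˡ xy≈0 ⟩
    x⁻¹ * 0#         ≈⟨ zeroʳ x⁻¹ ⟩
    0#               ∎
    where x⁻¹ = proj₁ (inverse x x≉0)

  pivot-cancel : ∀ x y z → y * z ≈ 1# → x + - (x * z) * y ≈ 0#
  pivot-cancel x y z yz≈1 = begin
    x + - (x * z) * y    ≈⟨ +-congˡ (-‿distribˡ-* (x * z) y) ⟨
    x + - ((x * z) * y)  ≈⟨ +-congˡ (-‿cong (*-assoc x z y)) ⟩
    x + - (x * (z * y))  ≈⟨ +-congˡ (-‿cong (*-congˡ (trans (*-comm z y) yz≈1))) ⟩
    x + - (x * 1#)       ≈⟨ +-congˡ (-‿cong (*-identityʳ x)) ⟩
    x + - x              ≈⟨ -‿inverseʳ x ⟩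
    0#                   ∎

  ∑≡sum : ∀ {k} (f : Fin k → Carrier) → ∑ f ≡ Sum.sum f
  ∑≡sum {ℕ.zero} f = ≡.refl
  ∑≡sum {suc k}  f = ≡.cong (f zero +_) (∑≡sum (f ∘ suc))

  ∑-cong : ∀ {k} {f g : Fin k → Carrier} → (∀ j → f j ≈ g j) → ∑ f ≈ ∑ g
  ∑-cong {f = f} {g} f≈g = begin
    ∑ f        ≡⟨ ∑≡sum f ⟩
    Sum.sum f  ≈⟨ Sum.sum-cong-≋ f≈g ⟩
    Sum.sum g  ≡⟨ ∑≡sum g ⟨
    ∑ g        ∎

  ∑-zero : ∀ {k} {f : Fin k → Carrier} → (∀ j → f j ≈ 0#) → ∑ f ≈ 0#
  ∑-zero {k} {f} f≈0 = begin
    ∑ f                  ≈⟨ ∑-cong f≈0 ⟩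
    ∑ zeros              ≡⟨ ∑≡sum zeros ⟩
    Sum.sum zeros        ≈⟨ Sum.sum-replicate-zero k ⟩
    0#                   ∎
    where
    zeros : Fin k → Carrier
    zeros _ = 0#

  ∑-distrib-+ : ∀ {k} (f g : Fin k → Carrier) → ∑ (λ j → f j + g j) ≈ ∑ f + ∑ g
  ∑-distrib-+ f g = begin
    ∑ (λ j → f j + g j)        ≡⟨ ∑≡sum (λ j → f j + g j) ⟩
    Sum.sum (λ j → f j + g j)  ≈⟨ Sum.∑-distrib-+ f g ⟩
    Sum.sum f + Sum.sum g      ≡⟨ ≡.cong₂ _+_ (∑≡sum f) (∑≡sum g) ⟨
    ∑ f + ∑ g                  ∎

  *-distribˡ-∑ : ∀ {k} x (f : Fin k → Carrier) → x * ∑ f ≈ ∑ (λ j → x * f j)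
  *-distribˡ-∑ x f = begin
    x * ∑ f                  ≡⟨ ≡.cong (x *_) (∑≡sum f) ⟩
    x * Sum.sum f            ≈⟨ Sum.*-distribˡ-sum x f ⟩
    Sum.sum (λ j → x * f j)  ≡⟨ ∑≡sum (λ j → x * f j) ⟨
    ∑ (λ j → x * f j)        ∎

  *-distribʳ-∑ : ∀ {k} x (f : Fin k → Carrier) → ∑ f * x ≈ ∑ (λ j → f j * x)
  *-distribʳ-∑ x f = begin
    ∑ f * x                  ≡⟨ ≡.cong (_* x) (∑≡sum f) ⟩
    Sum.sum f * x            ≈⟨ Sum.*-distribʳ-sum x f ⟩
    Sum.sum (λ j → f j * x)  ≡⟨ ∑≡sum (λ j → f j * x) ⟨
    ∑ (λ j → f j * x)        ∎

  ∑-comm : ∀ {k l} (f : Fin k → Fin l → Carrier) →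
           ∑ (λ i → ∑ (f i)) ≈ ∑ (λ j → ∑ (λ i → f i j))
  ∑-comm f = begin
    ∑ (λ i → ∑ (f i))                      ≡⟨ ∑≡sum (λ i → ∑ (f i)) ⟩
    Sum.sum (λ i → ∑ (f i))                ≡⟨ Sum.sum-cong-≗ (∑≡sum ∘ f) ⟩
    Sum.sum (λ i → Sum.sum (f i))          ≈⟨ Sum.∑-comm f ⟩
    Sum.sum (λ j → Sum.sum (λ i → f i j))  ≡⟨ Sum.sum-cong-≗ (∑≡sum ∘ flip f) ⟨
    Sum.sum (λ j → ∑ (λ i → f i j))        ≡⟨ ∑≡sum (λ j → ∑ (λ i → f i j)) ⟨
    ∑ (λ j → ∑ (λ i → f i j))              ∎

  ∑-remove : ∀ {k} (i : Fin (suc k)) (f : Fin (suc k) → Carrier) →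
             ∑ f ≈ f i + ∑ (f ∘ punchIn i)
  ∑-remove i f = begin
    ∑ f                            ≡⟨ ∑≡sum f ⟩
    Sum.sum f                      ≈⟨ Sum.sum-remove f ⟩
    f i + Sum.sum (f ∘ punchIn i)  ≡⟨ ≡.cong (f i +_) (∑≡sum (f ∘ punchIn i)) ⟨
    f i + ∑ (f ∘ punchIn i)        ∎

  ∑-reassoc : ∀ {k l} (c : Fin k → Carrier) (A : Fin k → Fin l → Carrier) (x : Fin l → Carrier) →
              ∑ (λ i → c i * ∑ (λ j → A i j * x j)) ≈ ∑ (λ j → ∑ (λ i → c i * A i j) * x j)
  ∑-reassoc c A x = begin
    ∑ (λ i → c i * ∑ (λ j → A i j * x j))
      ≈⟨ ∑-cong (λ i → *-distribˡ-∑ (c i) (λ j → A i j * x j)) ⟩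
    ∑ (λ i → ∑ (λ j → c i * (A i j * x j)))
      ≈⟨ ∑-comm (λ i j → c i * (A i j * x j)) ⟩
    ∑ (λ j → ∑ (λ i → c i * (A i j * x j)))
      ≈⟨ ∑-cong (λ j → ∑-cong (λ i → *-assoc (c i) (A i j) (x j))) ⟨
    ∑ (λ j → ∑ (λ i → (c i * A i j) * x j))
      ≈⟨ ∑-cong (λ j → *-distribʳ-∑ (x j) (λ i → c i * A i j)) ⟨
    ∑ (λ j → ∑ (λ i → c i * A i j) * x j)
      ∎

  ·-cong : ∀ {m n} {M N : Matrix m n} → M ≈ₘ N → ∀ x → (M · x) ≈ᵥ (N · x)
  ·-cong M≈N x a = ∑-cong (λ b → *-congʳ (M≈N a b))

  ·-scale : ∀ {m n} (M : Matrix m n) (y : Carrier) (x : Vector n) →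
            (M · (λ b → y * x b)) ≈ᵥ (λ a → y * (M · x) a)
  ·-scale M y x a = begin
    ∑ (λ b → M a b * (y * x b))  ≈⟨ ∑-cong (λ b → x∙yz≈y∙xz (M a b) y (x b)) ⟩
    ∑ (λ b → y * (M a b * x b))  ≈⟨ *-distribˡ-∑ y (λ b → M a b * x b) ⟨
    y * (M · x) a                ∎

  ·-combᵥ : ∀ {m n k} (M : Matrix m n) (cs : Fin k → Carrier) (xs : Fin k → Vector n) →
            (M · combᵥ cs xs) ≈ᵥ combᵥ cs (λ i → M · xs i)
  ·-combᵥ M cs xs a = begin
    ∑ (λ b → M a b * combᵥ cs xs b)
      ≈⟨ ∑-cong (λ b → *-comm (M a b) (combᵥ cs xs b)) ⟩
    ∑ (λ b → combᵥ cs xs b * M a b)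
      ≈⟨ ∑-reassoc cs xs (M a) ⟨
    ∑ (λ i → cs i * ∑ (λ b → xs i b * M a b))
      ≈⟨ ∑-cong (λ i → *-congˡ (∑-cong (λ b → *-comm (xs i b) (M a b)))) ⟩
    combᵥ cs (λ i → M · xs i) a
      ∎

  combₘ-· : ∀ {m n k} (cs : Fin k → Carrier) (Ms : Fin k → Matrix m n) (x : Vector n) →
            (combₘ cs Ms · x) ≈ᵥ combᵥ cs (λ i → Ms i · x)
  combₘ-· cs Ms x a = sym (∑-reassoc cs (λ i b → Ms i a b) x)

  combᵥ-combᵥ : ∀ {m s k} (cs : Fin k → Carrier) (as : Fin k → Vector s)
                (vs : Fin s → Vector m) →
                combᵥ cs (λ i → combᵥ (as i) vs) ≈ᵥ combᵥ (combᵥ cs as) vs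
  combᵥ-combᵥ cs as vs x = ∑-reassoc cs as (λ l → vs l x)

  LinIndepᵥ-tail : ∀ {s r} (ws : Fin r → Vector (suc s)) → (∀ k → ws k zero ≈ 0#) →
                   LinIndepᵥ ws → LinIndepᵥ (tail ∘ ws)
  LinIndepᵥ-tail ws ws₀≈0 ind cs comb≈0 = ind cs λ
    { zero    → ∑-zero (λ k → trans (*-congˡ (ws₀≈0 k)) (zeroʳ (cs k)))
    ; (suc a) → comb≈0 a
    }

  LinIndepᵥ-shear : ∀ {s r} (ws : Fin (suc r) → Vector s) (k : Fin (suc r))
                    (e : Fin r → Carrier) →
                    LinIndepᵥ ws → LinIndepᵥ (λ t a → ws (punchIn k t) a + e t * ws k a)
  LinIndepᵥ-shear ws k e ind cs comb≈0 t = begin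
    cs t             ≡⟨ insertAt-punchIn cs k E t ⟨
    d (punchIn k t)  ≈⟨ ind d comb-d≈0 (punchIn k t) ⟩
    0#               ∎
    where
    E : Carrier
    E = ∑ (λ t → cs t * e t)
    d : Fin (suc _) → Carrier
    d = insertAt cs k E
    comb-d≈0 : combᵥ d ws ≈ᵥ 0ᵥ
    comb-d≈0 a = begin
      ∑ (λ j → d j * ws j a)
        ≈⟨ ∑-remove k (λ j → d j * ws j a) ⟩
      d k * ws k a + ∑ (λ t → d (punchIn k t) * ws (punchIn k t) a)
        ≈⟨ +-cong (*-congʳ (reflexive (insertAt-lookup cs k E)))
                  (∑-cong (λ t → *-congʳ (reflexive (insertAt-punchIn cs k E t)))) ⟩
      E * ws k a + ∑ (λ t → cs t * ws (punchIn k t) a)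
        ≈⟨ +-comm (E * ws k a) _ ⟩
      ∑ (λ t → cs t * ws (punchIn k t) a) + E * ws k a
        ≈⟨ +-congˡ (*-distribʳ-∑ (ws k a) (λ t → cs t * e t)) ⟩
      ∑ (λ t → cs t * ws (punchIn k t) a) + ∑ (λ t → (cs t * e t) * ws k a)
        ≈⟨ ∑-distrib-+ (λ t → cs t * ws (punchIn k t) a) (λ t → cs t * e t * ws k a) ⟨
      ∑ (λ t → cs t * ws (punchIn k t) a + (cs t * e t) * ws k a)
        ≈⟨ ∑-cong (λ t → trans (+-congˡ (*-assoc (cs t) (e t) (ws k a)))
                                (sym (distribˡ (cs t) _ _))) ⟩
      ∑ (λ t → cs t * (ws (punchIn k t) a + e t * ws k a))
        ≈⟨ comb≈0 a ⟩
      0# ∎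

  -- Gaussian elimination on the first coordinate.
  LinIndepᵥ⇒≤ : ∀ {s r} (ws : Fin r → Vector s) → LinIndepᵥ ws → r ≤ s
  LinIndepᵥ⇒≤ {r = ℕ.zero}    ws ind = ℕ.z≤n
  LinIndepᵥ⇒≤ {ℕ.zero} {suc r} ws ind = ⊥-elim (0≉1 (sym (ind (λ _ → 1#) (λ ()) zero)))
  LinIndepᵥ⇒≤ {suc s}  {suc r} ws ind = decidable-stable (suc r ℕ.≤? suc s) λ r≰s →
    ¬¬-∀-Fin (λ k wₖ₀≉0 → r≰s (ℕ.s≤s (eliminate k wₖ₀≉0)))
             (λ ws₀≈0 → r≰s (ℕ.m≤n⇒m≤1+n
               (LinIndepᵥ⇒≤ (tail ∘ ws) (LinIndepᵥ-tail ws ws₀≈0 ind))))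
    where
    eliminate : ∀ k → ¬ ws k zero ≈ 0# → r ≤ s
    eliminate k wₖ₀≉0 =
      LinIndepᵥ⇒≤ (tail ∘ ws′) (LinIndepᵥ-tail ws′ ws′₀≈0 (LinIndepᵥ-shear ws k e ind))
      where
      w⁻¹ : Carrier
      w⁻¹ = proj₁ (inverse (ws k zero) wₖ₀≉0)
      e : Fin r → Carrier
      e t = - (ws (punchIn k t) zero * w⁻¹)
      ws′ : Fin r → Vector (suc s)
      ws′ t a = ws (punchIn k t) a + e t * ws k a
      ws′₀≈0 : ∀ t → ws′ t zero ≈ 0#
      ws′₀≈0 t = pivot-cancel _ _ _ (proj₂ (inverse (ws k zero) wₖ₀≉0))

  LinIndepᵥ-in-span⇒≤ : ∀ {m s r} (vs : Fin s → Vector m) (ws : Fin r → Vector m) →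
                        LinIndepᵥ ws → (∀ k → InSpanᵥ vs (ws k)) → r ≤ s
  LinIndepᵥ-in-span⇒≤ vs ws ind ws∈span = LinIndepᵥ⇒≤ as as-indep
    where
    as : Fin _ → Vector _
    as k = proj₁ (ws∈span k)
    as-indep : LinIndepᵥ as
    as-indep cs comb≈0 = ind cs λ x → begin
      combᵥ cs ws x
        ≈⟨ ∑-cong (λ k → *-congˡ (proj₂ (ws∈span k) x)) ⟩
      combᵥ cs (λ k → combᵥ (as k) vs) x
        ≈⟨ combᵥ-combᵥ cs as vs x ⟩
      combᵥ (combᵥ cs as) vs x
        ≈⟨ ∑-zero (λ l → trans (*-congʳ (comb≈0 l)) (zeroˡ (vs l x))) ⟩
      0# ∎

  ker⊆ker⇒rank≤ : ∀ {m n r s} {M N : Matrix m n} →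
                  (∀ x → (M · x) ≈ᵥ 0ᵥ → (N · x) ≈ᵥ 0ᵥ) →
                  HasRank N r → HasRank M s → r ≤ s
  ker⊆ker⇒rank≤ {M = M} {N} ker⊆ker (ws , ws∈Im , ws-indep , _) (us , _ , _ , us-span) =
    LinIndepᵥ-in-span⇒≤ us (λ k → M · xs k) Mxs-indep
                        (λ k → us-span (M · xs k) (xs k , λ _ → refl))
    where
    xs : Fin _ → Vector _
    xs k = proj₁ (ws∈Im k)
    Mxs-indep : LinIndepᵥ (λ k → M · xs k)
    Mxs-indep cs comb≈0 = ws-indep cs λ a → begin
      combᵥ cs ws a                ≈⟨ ∑-cong (λ k → *-congˡ (sym (proj₂ (ws∈Im k) a))) ⟩
      combᵥ cs (λ k → N · xs k) a  ≈⟨ ·-combᵥ N cs xs a ⟨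
      (N · combᵥ cs xs) a          ≈⟨ ker⊆ker (combᵥ cs xs) M-comb≈0 a ⟩
      0#                           ∎
      where
      M-comb≈0 : (M · combᵥ cs xs) ≈ᵥ 0ᵥ
      M-comb≈0 a = trans (·-combᵥ M cs xs a) (comb≈0 a)

  ker⊆ker-component : ∀ {m n p} {M : Matrix m n} {Ms : Fin p → Matrix m n}
                      {λs : Fin p → Carrier} →
                      ImagesInDirectSum Ms → M ≈ₘ combₘ λs Ms → ∀ {j} → ¬ λs j ≈ 0# →
                      ∀ x → (M · x) ≈ᵥ 0ᵥ → (Ms j · x) ≈ᵥ 0ᵥ
  ker⊆ker-component {m} {M = M} {Ms} {λs} direct M≈comb {j} λⱼ≉0 x Mx≈0 a =
    nonzero*y≈0⇒y≈0 λⱼ≉0 (direct ys ys∈Im ∑ys≈0 j a)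
    where
    ys : Fin _ → Vector m
    ys l a = λs l * (Ms l · x) a
    ys∈Im : ∀ l → Im (Ms l) (ys l)
    ys∈Im l = (λ b → λs l * x b) , ·-scale (Ms l) (λs l) x
    ∑ys≈0 : sumᵥ ys ≈ᵥ 0ᵥ
    ∑ys≈0 a = begin
      sumᵥ ys a             ≈⟨ combₘ-· λs Ms x a ⟨
      (combₘ λs Ms · x) a   ≈⟨ ·-cong M≈comb x a ⟨
      (M · x) a             ≈⟨ Mx≈0 a ⟩
      0#                    ∎

  extend : ∀ {p} (i : Fin p) → (Fin (toℕ i) → Carrier) → Carrier → Fin p → Carrier
  extend zero    μ y zero    = y
  extend zero    μ y (suc j) = 0#
  extend (suc i) μ y zero    = μ zero
  extend (suc i) μ y (suc j) = extend i (μ ∘ suc) y j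

  extend-at : ∀ {p} (i : Fin p) μ y → extend i μ y i ≡ y
  extend-at zero    μ y = ≡.refl
  extend-at (suc i) μ y = extend-at i (μ ∘ suc) y

  ∑-extend : ∀ {p} (i : Fin p) μ y (f : Fin p → Carrier) →
             ∑ (λ j → extend i μ y j * f j) ≈ ∑ (λ t → μ t * f (inject t)) + y * f i
  ∑-extend zero μ y f =
    trans (+-congˡ (∑-zero (λ j → zeroˡ (f (suc j))))) (+-comm (y * f zero) 0#)
  ∑-extend (suc i) μ y f =
    trans (+-congˡ (∑-extend i (μ ∘ suc) y (f ∘ suc))) (sym (+-assoc _ _ _))

  ∑-prefix : ∀ {p} (i : Fin p) (f : Fin p → Carrier) →
             (∀ j → toℕ i ≤ toℕ j → f j ≈ 0#) → ∑ f ≈ ∑ (λ t → f (inject {i = i} t))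
  ∑-prefix zero    f f≈0 = ∑-zero (λ j → f≈0 j ℕ.z≤n)
  ∑-prefix (suc i) f f≈0 =
    +-congˡ (∑-prefix i (f ∘ suc) λ j i≤j → f≈0 (suc j) (ℕ.s≤s i≤j))

  InSpanₘ-member : ∀ {m n p} (Ms : Fin p → Matrix m n) i → InSpanₘ Ms (Ms i)
  InSpanₘ-member Ms i = extend i (λ _ → 0#) 1# , λ a b → sym (begin
    combₘ (extend i (λ _ → 0#) 1#) Ms a b
      ≈⟨ ∑-extend i _ 1# (λ j → Ms j a b) ⟩
    ∑ (λ t → 0# * Ms (inject {i = i} t) a b) + 1# * Ms i a b
      ≈⟨ +-cong (∑-zero (λ t → zeroˡ (Ms (inject {i = i} t) a b))) (*-identityˡ (Ms i a b)) ⟩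
    0# + Ms i a b
      ≈⟨ +-identityˡ (Ms i a b) ⟩
    Ms i a b
      ∎)

  LinIndepₘ⇒∉span-prefix : ∀ {m n p} {Ms : Fin p → Matrix m n} → LinIndepₘ Ms →
                           ∀ i → ¬ InSpanₘ (prefix Ms i) (Ms i)
  LinIndepₘ⇒∉span-prefix {Ms = Ms} indep i (μ , Mᵢ≈comb) = 0≉1 (begin
    0#          ≈⟨ -‿inverseʳ 1# ⟨
    1# + - 1#   ≈⟨ +-congˡ -1≈0 ⟩
    1# + 0#     ≈⟨ +-identityʳ 1# ⟩
    1#          ∎)
    where
    d : Fin _ → Carrier
    d = extend i μ (- 1#)
    comb-d≈0 : combₘ d Ms ≈ₘ 0ₘ
    comb-d≈0 a b = begin
      combₘ d Ms a b
        ≈⟨ ∑-extend i μ (- 1#) (λ j → Ms j a b) ⟩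
      combₘ μ (prefix Ms i) a b + - 1# * Ms i a b
        ≈⟨ +-cong (sym (Mᵢ≈comb a b)) (-1*x≈-x (Ms i a b)) ⟩
      Ms i a b + - Ms i a b
        ≈⟨ -‿inverseʳ (Ms i a b) ⟩
      0# ∎
    -1≈0 : - 1# ≈ 0#
    -1≈0 = trans (reflexive (≡.sym (extend-at i μ (- 1#)))) (indep d comb-d≈0 i)

  InSpanₘ-prefix : ∀ {m n p} {M : Matrix m n} {Ms : Fin p → Matrix m n} {λs : Fin p → Carrier} →
                   ∀ i → M ≈ₘ combₘ λs Ms → (∀ j → toℕ i ≤ toℕ j → λs j ≈ 0#) →
                   InSpanₘ (prefix Ms i) M
  InSpanₘ-prefix {Ms = Ms} {λs} i M≈comb λs≈0 = (λ t → λs (inject t)) , λ a b →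
    trans (M≈comb a b) (∑-prefix i (λ j → λs j * Ms j a b) λ j i≤j →
      trans (*-congʳ (λs≈0 j i≤j)) (zeroˡ (Ms j a b)))

  rank-outside-prefix-span : ∀ {m n p} {Ms : Fin p → Matrix m n} {r : Fin p → ℕ} →
    ImagesInDirectSum Ms → (∀ j → HasRank (Ms j) (r j)) →
    (∀ {i j} → toℕ i ≤ toℕ j → r i ≤ r j) →
    ∀ {M λs} i → M ≈ₘ combₘ λs Ms → ¬ InSpanₘ (prefix Ms i) M →
    ∀ {s} → HasRank M s → r i ≤ s
  rank-outside-prefix-span {r = r} direct rank mono {λs = λs} i M≈comb M∉span {s} rankM =
    decidable-stable (r i ℕ.≤? s) λ rᵢ≰s →
      ¬¬-∀-Fin (λ j → ¬¬-→ λ i≤j λⱼ≉0 → rᵢ≰s (ℕ.≤-trans (mono i≤j) (rank-component≤ λⱼ≉0)))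
               (M∉span ∘ InSpanₘ-prefix i M≈comb)
    where
    rank-component≤ : ∀ {j} → ¬ λs j ≈ 0# → r j ≤ s
    rank-component≤ {j} λⱼ≉0 =
      ker⊆ker⇒rank≤ (ker⊆ker-component direct M≈comb λⱼ≉0) (rank j) rankM

proposition5p1 : ∀ {c ℓ v : Level} (K : Field c ℓ) → let open LinearAlgebra K in
    ∀ {m n p : ℕ} (V : Matrix m n → Set v) (Ms : Fin p → Matrix m n) (r : Fin p → ℕ) →
    IsBasisₘ V Ms →
    (∀ j → HasRank (Ms j) (r j)) →
    (∀ j k → toℕ k ≡ suc (toℕ j) → r j ≤ r k) →
    ImagesInDirectSum Ms →
    ∀ (i : Fin p) →
      ((V (Ms i) × ¬ InSpanₘ (prefix Ms i) (Ms i)) × HasRank (Ms i) (r i))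
      × (∀ (M : Matrix m n) → V M → ¬ InSpanₘ (prefix Ms i) M → ∀ (s : ℕ) → HasRank M s → r i ≤ s)
proposition5p1 K V Ms r (indep , V⇔span) rank step direct i =
  ( (proj₂ (V⇔span (Ms i)) (InSpanₘ-member K Ms i) , LinIndepₘ⇒∉span-prefix K indep i)
  , rank i ) ,
  λ M M∈V M∉span s rankM →
    rank-outside-prefix-span K direct rank (suc-step⇒monotone r step) i
      (proj₂ (proj₁ (V⇔span M) M∈V)) M∉span rankM
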